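{- Let $G$ be a fork-free graph and $I$ an independent set of $G$ such that no vertex of $G$ is adjacent to three or more vertices of $I$. Let $u$ be an $I$-free vertex of $G$, let $v\in I$, and let $P$ be a shortest path from $u$ to $v$ in $G$. If $P$ has length at least three, then the neighbor of $u$ on $P$ has at most one neighbor in $I$.
   Context: A vertex $u$ is $I$-free if $u\notin I$ and $I\cup\{u\}$ is independent. The length of a path is its number of edges. A fork is the claw $K_{1,3}$ with one edge subdivided once; fork-free means no induced fork. -}

module Defs where

open import Data.Nat using (ℕ; zero; suc; _≤_)
open import Data.Fin using (Fin; zero; suc; inject₁; fromℕ)
open import Data.Fin.Subset using (Subset; _∈_; _∉_)
open import Data.Product using (Σ; _×_; _,_)
open import Relation.Nullary using (¬_)
open import Data.Empty using (⊥)
open import Relation.Binary.PropositionalEquality using (_≡_; _≢_)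
open import Function.Definitions using (Injective)

record Graph : Set₁ where
  field
    n     : ℕ
    _~_   : Fin n → Fin n → Set
    sym   : ∀ {x y} → x ~ y → y ~ x
    irrefl : ∀ {x} → ¬ (x ~ x)

open Graph public

module _ (G : Graph) where
  private
    V = Fin (n G)
    _∼_ = _~_ G

  -- An induced fork: center a with leaves b, c, d, and e attached to d.
  -- (The claw K_{1,3} with the edge a d subdivided by d.)
  IsInducedFork : V → V → V → V → V → Set
  IsInducedFork a b c d e =
    (a ≢ b) × (a ≢ c) × (a ≢ d) × (a ≢ e) × (b ≢ c) × (b ≢ d) × (b ≢ e) ×
    (c ≢ d) × (c ≢ e) × (d ≢ e) ×
    (a ∼ b) × (a ∼ c) × (a ∼ d) × (d ∼ e) ×
    ¬ (a ∼ e) × ¬ (b ∼ c) × ¬ (b ∼ d) × ¬ (b ∼ e) × ¬ (c ∼ d) × ¬ (c ∼ e)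

  ForkFree : Set
  ForkFree = ∀ a b c d e → ¬ IsInducedFork a b c d e

  Independent : Subset (n G) → Set
  Independent I = ∀ x y → x ∈ I → y ∈ I → ¬ (x ∼ y)

  IsFree : Subset (n G) → V → Set
  IsFree I u = u ∉ I × (∀ x → x ∈ I → ¬ (u ∼ x))

  NoVertexWith3NbrsIn : Subset (n G) → Set
  NoVertexWith3NbrsIn I = ∀ x a b c → a ∈ I → b ∈ I → c ∈ I →
    x ∼ a → x ∼ b → x ∼ c → a ≢ b → a ≢ c → b ≢ c → ⊥

  AtMostOneNbrIn : Subset (n G) → V → Set
  AtMostOneNbrIn I x = ∀ a b → a ∈ I → b ∈ I → x ∼ a → x ∼ b → a ≡ b

  IsPath : (k : ℕ) → (Fin (suc k) → V) → Set
  IsPath k p = Injective _≡_ _≡_ p × (∀ (i : Fin k) → p (inject₁ i) ∼ p (suc i))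

  IsPathFromTo : V → V → (k : ℕ) → (Fin (suc k) → V) → Set
  IsPathFromTo u v k p = IsPath k p × (p zero ≡ u) × (p (fromℕ k) ≡ v)

  IsShortestPath : V → V → (k : ℕ) → (Fin (suc k) → V) → Set
  IsShortestPath u v k p = IsPathFromTo u v k p ×
    (∀ m (q : Fin (suc m) → V) → IsPathFromTo u v m q → k ≤ m)

{-# OPTIONS --safe #-}
module Submission where

-- Splicing any shorter connection between a prefix and a suffix of a shortest path
-- contradicts minimality, so P has no chords, and a neighbour x of p₁ is adjacent to
-- no pᵢ with i ≥ 4 (p₀ p₁ x pᵢ … would be shorter). Let a, b be I-neighbours of p₁.
-- If exactly one of them, say b, is adjacent to p₃, then p₁ with leaves p₀, a, b and
-- the edge b p₃ is a fork; if neither is, the fork at p₁ with leaves p₀, x ∈ {a, b}, p₂ and the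
-- edge p₂ p₃ forces both to be adjacent to p₂. Hence a and b hang off the start c of the
-- remaining path c … v, c ∈ {p₂, p₃}: either c = v ∈ I, or c has the three I-neighbours
-- a, b, v, or c with leaves a, b, c⁺ and the next edge c⁺ c⁺⁺ is a fork.

open import Defs hiding (sym)
open import Data.Nat using (ℕ; zero; suc; _+_; _∸_; _≤_; z≤n; s≤s; s≤s⁻¹)
open import Data.Nat.Properties
  using ( ≤-refl; ≤-trans; m≤n⇒m≤1+n; m∸n≤m; m∸n+n≡m; +-monoˡ-≤; +-cancelˡ-≤; +-comm; +-assoc
        ; module ≤-Reasoning)
open import Data.Fin using (Fin; zero; suc; toℕ; fromℕ; inject₁)
open import Data.Fin.Properties using (any?; suc-injective; toℕ≤pred[n]; _≟_)
open import Data.Fin.Subset using (Subset; _∈_)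
open import Data.Vec.Functional using (_∷_; tail)
open import Data.Product using (_,_; proj₁; proj₂)
open import Data.Empty using (⊥; ⊥-elim)
open import Function using (_∘_)
open import Function.Definitions using (Injective)
open import Relation.Nullary using (¬_; yes; no)
open import Relation.Nullary.Decidable using (¬¬-excluded-middle)
open import Relation.Binary.PropositionalEquality
  using (_≡_; _≢_; refl; sym; cong; subst; subst₂)

module _ (G : Graph) where
  private
    V = Fin (n G)
    _∼_ = _~_ G
    ∼-sym = Graph.sym G

  tail-path : ∀ {k} {P : Fin (suc (suc k)) → V} → IsPath G (suc k) P → IsPath G k (tail P)
  tail-path (inj , adj) = suc-injective ∘ inj , adj ∘ suc

  ∷-path : ∀ {k x} {P : Fin (suc k) → V} → IsPath G k P → x ∼ P zero → (∀ i → P i ≢ x) →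
           IsPath G (suc k) (x ∷ P)
  ∷-path {x = x} {P} (inj , adj) x∼P₀ x∉P = inj′ , adj′
    where
    inj′ : Injective _≡_ _≡_ (x ∷ P)
    inj′ {zero}  {zero}  _  = refl
    inj′ {zero}  {suc j} eq = ⊥-elim (x∉P j (sym eq))
    inj′ {suc i} {zero}  eq = ⊥-elim (x∉P i eq)
    inj′ {suc i} {suc j} eq = cong suc (inj eq)
    adj′ : ∀ i → (x ∷ P) (inject₁ i) ∼ (x ∷ P) (suc i)
    adj′ zero    = x∼P₀
    adj′ (suc i) = adj i

  record Path≤ (m : ℕ) (u v : V) : Set where
    constructor path≤
    field
      length   : ℕ
      length≤m : length ≤ m
      path     : Fin (suc length) → V
      isPath   : IsPathFromTo G u v length path

  Path≤-mono : ∀ {m m′ u v} → m ≤ m′ → Path≤ m u v → Path≤ m′ u v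
  Path≤-mono m≤m′ (path≤ l l≤m R isR) = path≤ l (≤-trans l≤m m≤m′) R isR

  Path≤-refl : ∀ u → Path≤ 0 u u
  Path≤-refl u = path≤ 0 z≤n (λ _ → u) ((single-injective , λ ()) , refl , refl)
    where
    single-injective : Injective _≡_ _≡_ (λ (_ : Fin 1) → u)
    single-injective {zero} {zero} _ = refl

  Path≤-suffix : ∀ {k} {P : Fin (suc k) → V} → IsPath G k P → (s : Fin (suc k)) →
                 Path≤ (k ∸ toℕ s) (P s) (P (fromℕ k))
  Path≤-suffix {k} {P} isP zero = path≤ k ≤-refl P (isP , refl , refl)
  Path≤-suffix {suc k} isP (suc s) = Path≤-suffix (tail-path isP) s

  -- If x already lies on the path, its suffix from x is no longer.
  Path≤-∷ : ∀ {m x y v} → x ∼ y → Path≤ m y v → Path≤ (suc m) x v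
  Path≤-∷ {x = x} x∼y (path≤ l l≤m R (isR , R₀ , Rₗ)) with any? (λ s → R s ≟ x)
  ... | yes (s , Rs≡x) =
    Path≤-mono (≤-trans (m∸n≤m l (toℕ s)) (m≤n⇒m≤1+n l≤m))
      (subst₂ (Path≤ (l ∸ toℕ s)) Rs≡x Rₗ (Path≤-suffix isR s))
  ... | no x∉R =
    path≤ (suc l) (s≤s l≤m) (x ∷ R)
      (∷-path isR (subst (x ∼_) (sym R₀) x∼y) (λ i Ri≡x → x∉R (i , Ri≡x)) , refl , Rₗ)

  Path≤-edge : ∀ {x y} → x ∼ y → Path≤ 1 x y
  Path≤-edge x∼y = Path≤-∷ x∼y (Path≤-refl _)

  Path≤-prefix : ∀ {k} {P : Fin (suc k) → V} → IsPath G k P → (t : Fin (suc k)) →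
                 Path≤ (toℕ t) (P zero) (P t)
  Path≤-prefix {P = P} isP zero = Path≤-refl (P zero)
  Path≤-prefix {suc k} isP@(_ , adj) (suc t) = Path≤-∷ (adj zero) (Path≤-prefix (tail-path isP) t)

  Path≤-trans : ∀ {a b u w v} → Path≤ a u w → Path≤ b w v → Path≤ (a + b) u v
  Path≤-trans {b = b} (path≤ l l≤a R (isR , refl , refl)) q =
    Path≤-mono (+-monoˡ-≤ b l≤a) (along isR q)
    where
    along : ∀ {l} {R : Fin (suc l) → V} {v} → IsPath G l R → Path≤ b (R (fromℕ l)) v →
            Path≤ (l + b) (R zero) v
    along {zero}  _            q = q
    along {suc l} isR@(_ , adj) q = Path≤-∷ (adj zero) (along (tail-path isR) q)

  shortest-≤ : ∀ {u v k m P} → IsShortestPath G u v k P → Path≤ m u v → k ≤ m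
  shortest-≤ (_ , minimal) (path≤ l l≤m R isR) = ≤-trans (minimal l R isR) l≤m

  shortest-shortcut : ∀ {u v k d} {P : Fin (suc k) → V} → IsShortestPath G u v k P →
                      (i t : Fin (suc k)) → Path≤ d (P i) (P t) → toℕ t ≤ toℕ i + d
  shortest-shortcut {k = k} {d} sp@((isP , refl , refl) , _) i t q =
    +-cancelˡ-≤ (k ∸ toℕ t) (toℕ t) (toℕ i + d) (begin
      k ∸ toℕ t + toℕ t         ≡⟨ m∸n+n≡m (toℕ≤pred[n] t) ⟩
      k                         ≤⟨ shortest-≤ sp (Path≤-trans (Path≤-prefix isP i)
                                     (Path≤-trans q (Path≤-suffix isP t))) ⟩
      toℕ i + (d + (k ∸ toℕ t)) ≡⟨ sym (+-assoc (toℕ i) d (k ∸ toℕ t)) ⟩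
      toℕ i + d + (k ∸ toℕ t)   ≡⟨ +-comm (toℕ i + d) (k ∸ toℕ t) ⟩
      k ∸ toℕ t + (toℕ i + d)   ∎)
    where open ≤-Reasoning

  -- Apart from b ≢ c, all distinctness conditions follow from the edges and non-edges.
  induced-fork : ∀ {a b c d e} → a ∼ b → a ∼ c → a ∼ d → d ∼ e → b ≢ c →
                 ¬ a ∼ e → ¬ b ∼ c → ¬ b ∼ d → ¬ b ∼ e → ¬ c ∼ d → ¬ c ∼ e →
                 IsInducedFork G a b c d e
  induced-fork a∼b a∼c a∼d d∼e b≢c a≁e b≁c b≁d b≁e c≁d c≁e =
    (λ { refl → irrefl G a∼b }) , (λ { refl → irrefl G a∼c }) , (λ { refl → irrefl G a∼d }) ,
    (λ { refl → b≁e (∼-sym a∼b) }) , b≢c , (λ { refl → b≁e d∼e }) ,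
    (λ { refl → a≁e a∼b }) , (λ { refl → c≁e d∼e }) , (λ { refl → a≁e a∼c }) ,
    (λ { refl → irrefl G d∼e }) ,
    a∼b , a∼c , a∼d , d∼e , a≁e , b≁c , b≁d , b≁e , c≁d , c≁e

  module _ (fork-free : ForkFree G) (I : Subset (n G)) (indep : Independent G I)
           (no3 : NoVertexWith3NbrsIn G I) where

    record Pendant {m} (Q : Fin (suc m) → V) (x : V) : Set where
      field
        ∈I     : x ∈ I
        ≢end   : x ≢ Q (fromℕ m)
        start∼ : Q zero ∼ x
        ≁rest  : ∀ t → ¬ x ∼ Q (suc t)

    pendant-pair : ∀ {m a b} {Q : Fin (suc m) → V} → IsPath G m Q → Q (fromℕ m) ∈ I →
                   (∀ t → Q zero ∼ Q t → toℕ t ≤ 1) → Pendant Q a → Pendant Q b → a ≢ b → ⊥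
    pendant-pair {zero} {a} {Q = Q} _ end∈I _ pa _ _ =
      indep (Q zero) a end∈I (Pendant.∈I pa) (Pendant.start∼ pa)
    pendant-pair {suc zero} {a} {b} {Q} (_ , adj) end∈I _ pa pb a≢b =
      no3 (Q zero) a b (Q (suc zero)) (∈I pa) (∈I pb) end∈I (start∼ pa) (start∼ pb) (adj zero)
        a≢b (≢end pa) (≢end pb)
      where open Pendant
    pendant-pair {suc (suc m)} {a} {b} {Q} (_ , adj) _ chord pa pb a≢b =
      fork-free (Q zero) a b (Q (suc zero)) (Q (suc (suc zero)))
        (induced-fork (start∼ pa) (start∼ pb) (adj zero) (adj (suc zero)) a≢b Q₀≁Q₂
          (indep a b (∈I pa) (∈I pb))
          (≁rest pa zero) (≁rest pa (suc zero)) (≁rest pb zero) (≁rest pb (suc zero)))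
      where
      open Pendant
      Q₀≁Q₂ : ¬ Q zero ∼ Q (suc (suc zero))
      Q₀≁Q₂ e with chord (suc (suc zero)) e
      ... | s≤s ()

    module Geodesic (j : ℕ) (P : Fin (suc (3 + j)) → V)
                    (shortest : IsShortestPath G (P zero) (P (fromℕ (3 + j))) (3 + j) P)
                    (free : IsFree G I (P zero)) (end∈I : P (fromℕ (3 + j)) ∈ I) where

      p₀ p₁ p₂ p₃ : V
      p₀ = P zero
      p₁ = P (suc zero)
      p₂ = P (suc (suc zero))
      p₃ = P (suc (suc (suc zero)))

      isP : IsPath G (3 + j) P
      isP = proj₁ (proj₁ shortest)

      adj : ∀ i → P (inject₁ i) ∼ P (suc i)
      adj = proj₂ isP

      shortcut : ∀ {d} (i t : Fin (suc (3 + j))) → Path≤ d (P i) (P t) → toℕ t ≤ toℕ i + d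
      shortcut = shortest-shortcut shortest

      p₀≁p₂ : ¬ p₀ ∼ p₂
      p₀≁p₂ e with shortcut zero (suc (suc zero)) (Path≤-edge e)
      ... | s≤s ()

      p₀≁p₃ : ¬ p₀ ∼ p₃
      p₀≁p₃ e with shortcut zero (suc (suc (suc zero))) (Path≤-edge e)
      ... | s≤s ()

      p₁≁p₃ : ¬ p₁ ∼ p₃
      p₁≁p₃ e with shortcut (suc zero) (suc (suc (suc zero))) (Path≤-edge e)
      ... | s≤s (s≤s ())

      p₁-neighbour-≢-end : ∀ {x} → p₁ ∼ x → x ≢ P (fromℕ (3 + j))
      p₁-neighbour-≢-end p₁∼x refl with shortcut (suc zero) (fromℕ (3 + j)) (Path≤-edge p₁∼x)
      ... | s≤s (s≤s ())

      p₁-neighbour-≁-beyond-p₃ : ∀ {x} → p₁ ∼ x → (t : Fin j) → ¬ x ∼ P (suc (suc (suc (suc t))))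
      p₁-neighbour-≁-beyond-p₃ p₁∼x t x∼P
        with shortcut (suc zero) (suc (suc (suc (suc t)))) (Path≤-∷ p₁∼x (Path≤-edge x∼P))
      ... | s≤s (s≤s (s≤s ()))

      p₂-chord : ∀ t → p₂ ∼ tail (tail P) t → toℕ t ≤ 1
      p₂-chord t e = s≤s⁻¹ (s≤s⁻¹ (shortcut (suc (suc zero)) (suc (suc t)) (Path≤-edge e)))

      p₃-chord : ∀ t → p₃ ∼ tail (tail (tail P)) t → toℕ t ≤ 1
      p₃-chord t e =
        s≤s⁻¹ (s≤s⁻¹ (s≤s⁻¹ (shortcut (suc (suc (suc zero))) (suc (suc (suc t))) (Path≤-edge e))))

      p₁-fork : ∀ {x w} → x ∈ I → p₁ ∼ x → ¬ x ∼ p₃ → p₁ ∼ w → w ∼ p₃ → ¬ p₀ ∼ w → ¬ ¬ x ∼ w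
      p₁-fork x∈I p₁∼x x≁p₃ p₁∼w w∼p₃ p₀≁w x≁w =
        fork-free p₁ p₀ _ _ p₃
          (induced-fork (∼-sym (adj zero)) p₁∼x p₁∼w w∼p₃ (λ { refl → proj₁ free x∈I }) p₁≁p₃
            (proj₂ free _ x∈I) p₀≁w p₀≁p₃ x≁w x≁p₃)

      pendant-at-p₂ : ∀ {x} → x ∈ I → p₁ ∼ x → x ∼ p₂ → ¬ x ∼ p₃ → Pendant (tail (tail P)) x
      pendant-at-p₂ {x} x∈I p₁∼x x∼p₂ x≁p₃ = record
        { ∈I = x∈I ; ≢end = p₁-neighbour-≢-end p₁∼x ; start∼ = ∼-sym x∼p₂ ; ≁rest = ≁rest }
        where
        ≁rest : ∀ t → ¬ x ∼ P (suc (suc (suc t)))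
        ≁rest zero    = x≁p₃
        ≁rest (suc t) = p₁-neighbour-≁-beyond-p₃ p₁∼x t

      pendant-at-p₃ : ∀ {x} → x ∈ I → p₁ ∼ x → x ∼ p₃ → Pendant (tail (tail (tail P))) x
      pendant-at-p₃ x∈I p₁∼x x∼p₃ = record
        { ∈I = x∈I ; ≢end = p₁-neighbour-≢-end p₁∼x ; start∼ = ∼-sym x∼p₃
        ; ≁rest = p₁-neighbour-≁-beyond-p₃ p₁∼x }

      p₁-has-no-two-I-neighbours : ∀ {a b} → a ∈ I → b ∈ I → p₁ ∼ a → p₁ ∼ b → a ≢ b → ⊥
      p₁-has-no-two-I-neighbours {a} {b} a∈I b∈I p₁∼a p₁∼b a≢b = ¬¬-excluded-middle λ where
        (yes a∼p₃) → ¬¬-excluded-middle λ where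
          (yes b∼p₃) → pendant-pair (tail-path (tail-path (tail-path isP))) end∈I p₃-chord
                         (pendant-at-p₃ a∈I p₁∼a a∼p₃) (pendant-at-p₃ b∈I p₁∼b b∼p₃) a≢b
          (no b≁p₃)  → p₁-fork b∈I p₁∼b b≁p₃ p₁∼a a∼p₃ (proj₂ free a a∈I) (indep b a b∈I a∈I)
        (no a≁p₃) → ¬¬-excluded-middle λ where
          (yes b∼p₃) → p₁-fork a∈I p₁∼a a≁p₃ p₁∼b b∼p₃ (proj₂ free b b∈I) (indep a b a∈I b∈I)
          (no b≁p₃)  →
            p₁-fork a∈I p₁∼a a≁p₃ (adj (suc zero)) (adj (suc (suc zero))) p₀≁p₂ λ a∼p₂ →
            p₁-fork b∈I p₁∼b b≁p₃ (adj (suc zero)) (adj (suc (suc zero))) p₀≁p₂ λ b∼p₂ →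
            pendant-pair (tail-path (tail-path isP)) end∈I p₂-chord
              (pendant-at-p₂ a∈I p₁∼a a∼p₂ a≁p₃) (pendant-at-p₂ b∈I p₁∼b b∼p₂ b≁p₃) a≢b

lemma6p7 : (G : Graph) → ForkFree G → (I : Subset (n G)) → Independent G I →
    NoVertexWith3NbrsIn G I → (u v : Fin (n G)) → IsFree G I u → v ∈ I →
    (j : ℕ) → (P : Fin (suc (3 + j)) → Fin (n G)) → IsShortestPath G u v (3 + j) P →
    AtMostOneNbrIn G I (P (suc zero))
lemma6p7 G fork-free I indep no3 u v free v∈I j P shortest@((_ , refl , refl) , _)
         a b a∈I b∈I p₁∼a p₁∼b with a ≟ b
... | yes a≡b = a≡b
... | no a≢b  = ⊥-elim (p₁-has-no-two-I-neighbours a∈I b∈I p₁∼a p₁∼b a≢b)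
  where open Geodesic G fork-free I indep no3 j P shortest free v∈I
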